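{- Let $n,m\ge 1$ and let $s_{ij}\in\{0,1\}$ for $1\le i\le n$, $1\le j\le m$. Put $l_i=\sum_{j=1}^m s_{ij}$ for $1\le i\le n$ and $r_j=\sum_{i=1}^n s_{ij}$ for $1\le j\le m$, and assume $l_1\ge l_i$ for all $1\le i\le n$ and $l_1\ge r_j$ for all $1\le j\le m$. Let $s=\sum_{i=1}^n\sum_{j=1}^m s_{ij}$, $b=s-l_1$, and $I=s^2-\sum_{i}l_i^2-\sum_j r_j^2+\sum_{i,j}s_{ij}^2$. Then $b^2\le I$. -}

module Defs where

open import Data.Nat using (ℕ; zero; suc; _+_)
open import Data.Fin using (Fin; zero; suc)

∑ᶠ : {n : ℕ} → (Fin n → ℕ) → ℕ
∑ᶠ {zero}  f = 0
∑ᶠ {suc n} f = f zero + ∑ᶠ (λ i → f (suc i))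

rowSum : {n m : ℕ} → (Fin n → Fin m → ℕ) → Fin n → ℕ
rowSum s i = ∑ᶠ (λ j → s i j)

colSum : {n m : ℕ} → (Fin n → Fin m → ℕ) → Fin m → ℕ
colSum s j = ∑ᶠ (λ i → s i j)

total : {n m : ℕ} → (Fin n → Fin m → ℕ) → ℕ
total s = ∑ᶠ (λ i → rowSum s i)

-- Write L = l₁, T = s and B = T − L. Every row sum is at most L, so Σ lᵢ² ≤ L·T.
-- Splitting a column sum as r_j = s₁ⱼ + c_j, where c_j is the part below the first
-- row, s₁ⱼ ≤ 1 and r_j ≤ L give r_j² ≤ r_j + L·c_j, so Σ r_j² ≤ T + L·B. As sᵢⱼ² = sᵢⱼ,
-- I ≥ T² − L·T − (T + L·B) + T = B².
module Submission where

open import Defs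
open import Data.Nat using (ℕ; suc; _≤_; z≤n) renaming (_*_ to _*ℕ_)
import Data.Nat as ℕ
import Data.Nat.Properties as ℕₚ
open import Data.Fin using (Fin; zero) renaming (suc to fsuc)
open import Data.Sum using (_⊎_; inj₁; inj₂)
open import Data.Integer using (+_; _+_; _-_; _*_; 0ℤ; +≤+) renaming (_≤_ to _≤ℤ_)
open import Data.Integer.Properties using (+-mono-≤; i≤j⇒0≤j-i; 0≤i-j⇒j≤i; pos-*)
open import Data.Integer.Tactic.RingSolver using (solve-∀)
open import Relation.Binary.PropositionalEquality
  using (_≡_; refl; sym; trans; cong; cong₂; subst; module ≡-Reasoning)
open import Algebra.Properties.Semiring.Sum ℕₚ.+-*-semiring
  using (sum; sum-cong-≗; ∑-distrib-+; ∑-comm; *-distribˡ-sum)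

∑ᶠ≡sum : ∀ {n} (f : Fin n → ℕ) → ∑ᶠ f ≡ sum f
∑ᶠ≡sum {ℕ.zero} f = refl
∑ᶠ≡sum {suc n}  f = cong (f zero ℕ.+_) (∑ᶠ≡sum (λ i → f (fsuc i)))

∑ᶠ-cong : ∀ {n} {f g : Fin n → ℕ} → (∀ i → f i ≡ g i) → ∑ᶠ f ≡ ∑ᶠ g
∑ᶠ-cong {f = f} {g} f≗g = trans (∑ᶠ≡sum f) (trans (sum-cong-≗ f≗g) (sym (∑ᶠ≡sum g)))

∑ᶠ-mono-≤ : ∀ {n} {f g : Fin n → ℕ} → (∀ i → f i ≤ g i) → ∑ᶠ f ≤ ∑ᶠ g
∑ᶠ-mono-≤ {ℕ.zero} f≤g = z≤n
∑ᶠ-mono-≤ {suc n}  f≤g = ℕₚ.+-mono-≤ (f≤g zero) (∑ᶠ-mono-≤ (λ i → f≤g (fsuc i)))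

∑ᶠ-distrib-+ : ∀ {n} (f g : Fin n → ℕ) → ∑ᶠ (λ i → f i ℕ.+ g i) ≡ ∑ᶠ f ℕ.+ ∑ᶠ g
∑ᶠ-distrib-+ f g = begin
  ∑ᶠ (λ i → f i ℕ.+ g i)  ≡⟨ ∑ᶠ≡sum (λ i → f i ℕ.+ g i) ⟩
  sum (λ i → f i ℕ.+ g i) ≡⟨ ∑-distrib-+ f g ⟩
  sum f ℕ.+ sum g         ≡⟨ cong₂ ℕ._+_ (∑ᶠ≡sum f) (∑ᶠ≡sum g) ⟨
  ∑ᶠ f ℕ.+ ∑ᶠ g           ∎
  where open ≡-Reasoning

*-distribˡ-∑ᶠ : ∀ {n} x (f : Fin n → ℕ) → x *ℕ ∑ᶠ f ≡ ∑ᶠ (λ i → x *ℕ f i)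
*-distribˡ-∑ᶠ x f = begin
  x *ℕ ∑ᶠ f              ≡⟨ cong (x *ℕ_) (∑ᶠ≡sum f) ⟩
  x *ℕ sum f             ≡⟨ *-distribˡ-sum x f ⟩
  sum (λ i → x *ℕ f i)   ≡⟨ ∑ᶠ≡sum (λ i → x *ℕ f i) ⟨
  ∑ᶠ (λ i → x *ℕ f i)    ∎
  where open ≡-Reasoning

∑ᶠ-comm : ∀ {n m} (f : Fin n → Fin m → ℕ) →
          ∑ᶠ (λ i → ∑ᶠ (λ j → f i j)) ≡ ∑ᶠ (λ j → ∑ᶠ (λ i → f i j))
∑ᶠ-comm f = begin
  ∑ᶠ (λ i → ∑ᶠ (λ j → f i j))   ≡⟨ ∑ᶠ²≡sum² f ⟩
  sum (λ i → sum (λ j → f i j)) ≡⟨ ∑-comm f ⟩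
  sum (λ j → sum (λ i → f i j)) ≡⟨ ∑ᶠ²≡sum² (λ j i → f i j) ⟨
  ∑ᶠ (λ j → ∑ᶠ (λ i → f i j))   ∎
  where
  open ≡-Reasoning
  ∑ᶠ²≡sum² : ∀ {n m} (g : Fin n → Fin m → ℕ) →
             ∑ᶠ (λ i → ∑ᶠ (λ j → g i j)) ≡ sum (λ i → sum (λ j → g i j))
  ∑ᶠ²≡sum² g = trans (∑ᶠ≡sum (λ i → ∑ᶠ (g i))) (sum-cong-≗ (λ i → ∑ᶠ≡sum (g i)))

total≡∑colSum : ∀ {n m} (s : Fin n → Fin m → ℕ) → total s ≡ ∑ᶠ (colSum s)
total≡∑colSum s = ∑ᶠ-comm s

x*x≡x : ∀ {x} → x ≡ 0 ⊎ x ≡ 1 → x *ℕ x ≡ x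
x*x≡x (inj₁ refl) = refl
x*x≡x (inj₂ refl) = refl

x≤1 : ∀ {x} → x ≡ 0 ⊎ x ≡ 1 → x ≤ 1
x≤1 (inj₁ refl) = z≤n
x≤1 (inj₂ refl) = ℕₚ.≤-refl

∑∑sq≡total : ∀ {n m} (s : Fin n → Fin m → ℕ) → (∀ i j → s i j ≡ 0 ⊎ s i j ≡ 1) →
             ∑ᶠ (λ i → ∑ᶠ (λ j → s i j *ℕ s i j)) ≡ total s
∑∑sq≡total s s01 = ∑ᶠ-cong (λ i → ∑ᶠ-cong (λ j → x*x≡x (s01 i j)))

∑rowSum²≤ : ∀ {n m} (s : Fin n → Fin m → ℕ) {L} → (∀ i → rowSum s i ≤ L) →
            ∑ᶠ (λ i → rowSum s i *ℕ rowSum s i) ≤ L *ℕ total s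
∑rowSum²≤ s {L} l≤L = begin
  ∑ᶠ (λ i → rowSum s i *ℕ rowSum s i) ≤⟨ ∑ᶠ-mono-≤ (λ i → ℕₚ.*-monoˡ-≤ (rowSum s i) (l≤L i)) ⟩
  ∑ᶠ (λ i → L *ℕ rowSum s i)          ≡⟨ *-distribˡ-∑ᶠ L (rowSum s) ⟨
  L *ℕ total s                        ∎
  where open ℕₚ.≤-Reasoning

[a+c]²≤a+c+L*c : ∀ {a c L} → a ≤ 1 → a ℕ.+ c ≤ L → (a ℕ.+ c) *ℕ (a ℕ.+ c) ≤ (a ℕ.+ c) ℕ.+ L *ℕ c
[a+c]²≤a+c+L*c {a} {c} {L} a≤1 r≤L = begin
  r *ℕ r           ≡⟨ ℕₚ.*-distribˡ-+ r a c ⟩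
  r *ℕ a ℕ.+ r *ℕ c ≤⟨ ℕₚ.+-mono-≤ (ℕₚ.*-monoʳ-≤ r a≤1) (ℕₚ.*-monoˡ-≤ c r≤L) ⟩
  r *ℕ 1 ℕ.+ L *ℕ c ≡⟨ cong (ℕ._+ L *ℕ c) (ℕₚ.*-identityʳ r) ⟩
  r ℕ.+ L *ℕ c     ∎
  where
  open ℕₚ.≤-Reasoning
  r = a ℕ.+ c

∑colSum²≤ : ∀ {n m} (s : Fin (suc n) → Fin m → ℕ) {L} → (∀ j → s zero j ≤ 1) → (∀ j → colSum s j ≤ L) →
            ∑ᶠ (λ j → colSum s j *ℕ colSum s j) ≤ total s ℕ.+ L *ℕ total (λ i → s (fsuc i))
∑colSum²≤ s {L} s₀≤1 r≤L = begin
  ∑ᶠ (λ j → colSum s j *ℕ colSum s j)           ≤⟨ ∑ᶠ-mono-≤ (λ j → [a+c]²≤a+c+L*c (s₀≤1 j) (r≤L j)) ⟩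
  ∑ᶠ (λ j → colSum s j ℕ.+ L *ℕ colSum s′ j)     ≡⟨ ∑ᶠ-distrib-+ (colSum s) (λ j → L *ℕ colSum s′ j) ⟩
  ∑ᶠ (colSum s) ℕ.+ ∑ᶠ (λ j → L *ℕ colSum s′ j) ≡⟨ cong₂ ℕ._+_ (total≡∑colSum s) (*-distribˡ-∑ᶠ L (colSum s′)) ⟨
  total s ℕ.+ L *ℕ ∑ᶠ (colSum s′)               ≡⟨ cong (λ t → total s ℕ.+ L *ℕ t) (total≡∑colSum s′) ⟨
  total s ℕ.+ L *ℕ total s′                     ∎
  where
  open ℕₚ.≤-Reasoning
  s′ = λ i → s (fsuc i)

[t-l]²≤t²-x-y+t : ∀ l b {x y} → x ≤ℤ l * (l + b) → y ≤ℤ (l + b) + l * b →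
                  (l + b - l) * (l + b - l) ≤ℤ (l + b) * (l + b) - x - y + (l + b)
[t-l]²≤t²-x-y+t l b {x} {y} x≤ y≤ =
  0≤i-j⇒j≤i (subst (0ℤ ≤ℤ_) (slack≡ l b x y) (+-mono-≤ (i≤j⇒0≤j-i x≤) (i≤j⇒0≤j-i y≤)))
  where
  slack≡ : ∀ l b x y → (l * (l + b) - x) + ((l + b) + l * b - y) ≡
                       (l + b) * (l + b) - x - y + (l + b) - (l + b - l) * (l + b - l)
  slack≡ = solve-∀

lemma7 : (n m : ℕ) (s : Fin (suc n) → Fin (suc m) → ℕ)
    → (∀ i j → s i j ≡ 0 ⊎ s i j ≡ 1)
    → (∀ i → rowSum s i ≤ rowSum s zero)
    → (∀ j → colSum s j ≤ rowSum s zero)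
    → let S = + total s
          b = S - (+ rowSum s zero)
          ∑l² = + ∑ᶠ (λ i → rowSum s i *ℕ rowSum s i)
          ∑r² = + ∑ᶠ (λ j → colSum s j *ℕ colSum s j)
          ∑s² = + ∑ᶠ (λ i → ∑ᶠ (λ j → s i j *ℕ s i j))
          I = S * S - ∑l² - ∑r² + ∑s²
      in b * b ≤ℤ I
-- total s unfolds to L ℕ.+ B, so + T is definitionally + L + + B.
lemma7 n m s s01 l≤l₀ r≤l₀ =
  subst (λ q → (+ T - + L) * (+ T - + L) ≤ℤ + T * + T - + X - + Y + + q)
        (sym (∑∑sq≡total s s01))
        ([t-l]²≤t²-x-y+t (+ L) (+ B) X≤ Y≤)
  where
  L T B X Y : ℕ
  L = rowSum s zero
  T = total s
  B = total (λ i → s (fsuc i))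
  X = ∑ᶠ (λ i → rowSum s i *ℕ rowSum s i)
  Y = ∑ᶠ (λ j → colSum s j *ℕ colSum s j)

  X≤ : + X ≤ℤ + L * + T
  X≤ = subst (+ X ≤ℤ_) (pos-* L T) (+≤+ (∑rowSum²≤ s l≤l₀))

  Y≤ : + Y ≤ℤ + T + + L * + B
  Y≤ = subst (λ z → + Y ≤ℤ + T + z) (pos-* L B) (+≤+ (∑colSum²≤ s (λ j → x≤1 (s01 zero j)) r≤l₀))
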